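{- Let $L$ be a field of characteristic $p$, let $d=p^\ell$ with $\ell\in\mathbb{N}$, for $\lambda\in\overline{L}$ let $f_\lambda(z)=z^d+\lambda$, and let $\alpha_1,\alpha_2,\beta\in L$. Set $\delta_1=\alpha_2-\alpha_1$ and $\delta_2=\beta-\alpha_1$. If (1) $\delta_1,\delta_2\in\mathbb{F}_{p^2}\setminus\mathbb{F}_p$, (2) $\delta_1-\delta_2\notin\mathbb{F}_p$, and (3) $\delta_1/\delta_2\notin\mathbb{F}_p$, then the set of $\lambda\in\overline{L}$ for which there exist $m,n\in\mathbb{N}$ with $f_\lambda^m(\alpha_1)=f_\lambda^n(\alpha_2)=\beta$ is empty.
   Context: $\mathbb{N}$ denotes the positive integers; $\overline{L}$ is an algebraic closure of $L$, and $\mathbb{F}_{p^2}$ is the subfield of $\overline{L}$ with $p^2$ elements; $f_\lambda^n$ is the $n$-th compositional iterate of $f_\lambda$. -}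

module Defs where

open import Level using (Level; _⊔_)
open import Data.Nat using (ℕ; zero; suc) renaming (_*_ to _ℕ*_)
open import Data.List using (List; []; _∷_; _++_; [_]; map)
open import Data.Product using (Σ; ∃; _×_; _,_)
open import Data.Nat.Primality using (Prime)
open import Relation.Nullary using (¬_)
open import Algebra.Bundles using (CommutativeRing)
open import Algebra.Morphism.Structures using (module RingMorphisms)

private variable c ℓ c₁ ℓ₁ c₂ ℓ₂ : Level

record Field (c ℓ : Level) : Set (Level.suc (c ⊔ ℓ)) where
  field
    commRing : CommutativeRing c ℓ
  open CommutativeRing commRing public
  field
    nontrivial : ¬ (1# ≈ 0#)
    inverse    : ∀ x → ¬ (x ≈ 0#) → ∃ λ y → (x * y) ≈ 1#

module FieldOps (F : Field c ℓ) where
  open Field F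

  natCast : ℕ → Carrier
  natCast zero    = 0#
  natCast (suc n) = 1# + natCast n

  pow : Carrier → ℕ → Carrier
  pow x zero    = 1#
  pow x (suc n) = x * pow x n

  eval : List Carrier → Carrier → Carrier
  eval []       x = 0#
  eval (a ∷ as) x = a + x * eval as x

  InPrimeField : Carrier → Set ℓ
  InPrimeField x = ∃ λ (n : ℕ) → x ≈ natCast n

  -- 𝔽_{p²} inside an algebraically closed field of characteristic p:
  -- the subfield of roots of X^{p²} − X
  InFp2 : ℕ → Carrier → Set ℓ
  InFp2 p x = pow x (p ℕ* p) ≈ x

HasCharacteristic : Field c ℓ → ℕ → Set ℓ
HasCharacteristic F p = Prime p × (natCast p ≈ 0#)
  where open Field F
        open FieldOps F

-- every monic polynomial of degree ≥ 1 (coefficients a₀ ∷ as, leading coeff 1) has a root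
IsAlgebraicallyClosed : Field c ℓ → Set (c ⊔ ℓ)
IsAlgebraicallyClosed F =
  ∀ (a₀ : Carrier) (as : List Carrier) → ∃ λ x → eval ((a₀ ∷ as) ++ [ 1# ]) x ≈ 0#
  where open Field F
        open FieldOps F

record IsAlgebraicClosure (L : Field c₁ ℓ₁) (K : Field c₂ ℓ₂)
       (ι : Field.Carrier L → Field.Carrier K) : Set (c₁ ⊔ ℓ₁ ⊔ c₂ ⊔ ℓ₂) where
  open RingMorphisms (CommutativeRing.rawRing (Field.commRing L)) (CommutativeRing.rawRing (Field.commRing K))
  field
    homomorphism : IsRingHomomorphism ι
    algClosed    : IsAlgebraicallyClosed K
    algebraic    : ∀ (x : Field.Carrier K) → ∃ λ (a₀ : Field.Carrier L) → ∃ λ (as : List (Field.Carrier L)) →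
                     Field._≈_ K (FieldOps.eval K (map ι ((a₀ ∷ as) ++ [ Field.1# L ])) x) (Field.0# K)

iter : ∀ {a} {A : Set a} → (A → A) → ℕ → A → A
iter f zero    x = x
iter f (suc n) x = f (iter f n x)

-- Write a = δ₁, b = δ₂, σ z = z^d and e k = f^k(α₁) − α₁. Since σ is additive in characteristic p,
-- f^k x − f^k y = σ^k (x − y), hence e (i + j) = σ^i (e j) + e i, and the set of k with e k ∈ 𝔽_{p²}
-- is closed under sums and differences. It contains m (e m = b) and n (e n = b − σ^n a), so it contains
-- g = gcd m n. On 𝔽_{p²} the Frobenius φ is an involution, so τ = σ^g acts there as the identity or as
-- φ, and E j = e (j g) satisfies E (j + 1) = τ (E j) + μ with μ = e g, E M = b and E N = b − τ^N a,
-- where m = M g and n = N g.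
-- If τ = id then E j = j μ, so either M ≡ 0 (mod p) and b = 0, or a = (1 − N/M) b with 1 − N/M ∈ 𝔽_p.
-- If τ = φ then E (2j) and E (2j + 1) − μ are fixed by φ, and the parities of M and N put b, a − b or a
-- into 𝔽_p. Here an element x fixed by φ is in 𝔽_p because otherwise z^p − z would have the p + 1
-- roots x, 0, 1, …, p − 1.

module Submission where

open import Defs
open import Level using (Level; _⊔_)
open import Data.Nat using (ℕ; _≤_; _^_)
open import Data.Product using (∃; ∃-syntax; _×_; _,_; proj₁; proj₂)
open import Relation.Nullary using (¬_; Dec; yes; no)
open import Algebra.Bundles using (CommutativeRing; CommutativeSemiring)
open import Algebra.Morphism.Structures using (module RingMorphisms)
open import Data.Empty using (⊥; ⊥-elim)
import Data.Fin.Base as Fin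
import Data.Fin.Properties as Fin
import Data.Integer.Base as ℤ
import Data.Integer.Properties as ℤ
open import Data.Maybe.Base using (just; nothing)
open import Data.Nat.Base as ℕ using (zero; suc; _<_; z≤n; s≤s; _!)
import Data.Nat.Properties as ℕ
open import Data.Nat.Combinatorics using (_C_; nCn≡1; nCk≡n!/k![n-k]!; k![n∸k]!∣n!)
open import Data.Nat.Coprimality using (prime⇒coprime; coprime-Bézout)
open import Data.Nat.DivMod using (m/n*n≡m)
open import Data.Nat.Divisibility using (_∣_; _∤_; divides; ∣1⇒≡1; ∣⇒≤)
open import Data.Nat.GCD using (gcd; gcd-GCD; gcd[m,n]∣m; gcd[m,n]∣n; module Bézout)
open import Data.Nat.Primality using (Prime; euclidsLemma; prime⇒nonZero; prime⇒nonTrivial)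
import Data.Sign.Base as Sign
open import Data.Sum.Base as Sum using (_⊎_; inj₁; inj₂; [_,_])
open import Data.Vec.Functional using (init; tail; last)
open import Relation.Binary.Bundles using (Setoid)
open import Relation.Binary.PropositionalEquality.Core as ≡ using (_≡_)
open import Relation.Nullary.Decidable.Core using (¬¬-excluded-middle)
open import Algebra.Solver.Ring.AlmostCommutativeRing
  using (_-Raw-AlmostCommutative⟶_; Induced-equivalence; fromCommutativeRing)
open import Relation.Binary.Definitions using (WeaklyDecidable)

-- With the ring's own elements as coefficients the solver could not decide cancellations such as
-- x - x ≈ 0, since equality in the ring is undecidable; integer coefficients make them decidable.
module IntegerCoefficientRingSolver {c ℓ} (R : CommutativeRing c ℓ) where

  open CommutativeRing R
  open import Data.Integer.Base using (ℤ; +_; -[1+_]; _⊖_; ∣_∣; sign; _◃_)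
  open import Algebra.Properties.Ring ring
    using (-1*x≈-x; -‿+-comm; -‿involutive; -0#≈0#)
  open import Algebra.Properties.Semiring.Mult.TCOptimised semiring
    using (×-homo-+; ×1-homo-*) renaming (_×_ to _×′_)
  open import Algebra.Properties.CommutativeSemigroup *-commutativeSemigroup
    using (interchange)
  open import Algebra.Properties.CommutativeSemigroup +-commutativeSemigroup
    using () renaming (interchange to +-interchange)
  open import Relation.Binary.Reasoning.Setoid setoid

  ⟦_⟧ℤ : ℤ → Carrier
  ⟦ + n ⟧ℤ      = n ×′ 1#
  ⟦ -[1+ n ] ⟧ℤ = - (suc n ×′ 1#)

  ⊖-homo : ∀ m n → ⟦ m ⊖ n ⟧ℤ ≈ m ×′ 1# - n ×′ 1#
  ⊖-homo m       zero    = sym (trans (+-congˡ -0#≈0#) (+-identityʳ _))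
  ⊖-homo zero    (suc n) = sym (+-identityˡ _)
  ⊖-homo (suc m) (suc n) = begin
    ⟦ suc m ⊖ suc n ⟧ℤ                 ≡⟨ ≡.cong ⟦_⟧ℤ (ℤ.[1+m]⊖[1+n]≡m⊖n m n) ⟩
    ⟦ m ⊖ n ⟧ℤ                         ≈⟨ ⊖-homo m n ⟩
    m ×′ 1# - n ×′ 1#                  ≈⟨ +-identityˡ _ ⟨
    0# + (m ×′ 1# - n ×′ 1#)           ≈⟨ +-congʳ (-‿inverseʳ 1#) ⟨
    (1# - 1#) + (m ×′ 1# - n ×′ 1#)    ≈⟨ +-interchange _ _ _ _ ⟩
    (1# + m ×′ 1#) + (- 1# - n ×′ 1#)
      ≈⟨ +-cong (×-homo-+ 1# 1 m) (trans (-‿cong (×-homo-+ 1# 1 n)) (sym (-‿+-comm _ _))) ⟨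
    suc m ×′ 1# - suc n ×′ 1#          ∎

  +-homo : ∀ i j → ⟦ i ℤ.+ j ⟧ℤ ≈ ⟦ i ⟧ℤ + ⟦ j ⟧ℤ
  +-homo -[1+ m ] -[1+ n ] = begin
    - (suc (suc (m ℕ.+ n)) ×′ 1#)    ≡⟨ ≡.cong (λ k → - (suc k ×′ 1#)) (ℕ.+-suc m n) ⟨
    - ((suc m ℕ.+ suc n) ×′ 1#)      ≈⟨ -‿cong (×-homo-+ 1# (suc m) (suc n)) ⟩
    - (suc m ×′ 1# + suc n ×′ 1#)    ≈⟨ -‿+-comm _ _ ⟨
    - (suc m ×′ 1#) - (suc n ×′ 1#)  ∎
  +-homo -[1+ m ] (+ n)    = trans (⊖-homo n (suc m)) (+-comm _ _)
  +-homo (+ m)    -[1+ n ] = ⊖-homo m (suc n)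
  +-homo (+ m)    (+ n)    = ×-homo-+ 1# m n

  -‿homo : ∀ i → ⟦ ℤ.- i ⟧ℤ ≈ - ⟦ i ⟧ℤ
  -‿homo (+ zero)  = sym -0#≈0#
  -‿homo (+ suc n) = refl
  -‿homo -[1+ n ]  = sym (-‿involutive _)

  ⟦_⟧ₛ : Sign.Sign → Carrier
  ⟦ Sign.+ ⟧ₛ = 1#
  ⟦ Sign.- ⟧ₛ = - 1#

  ⟦⟧ₛ-homo : ∀ s t → ⟦ s Sign.* t ⟧ₛ ≈ ⟦ s ⟧ₛ * ⟦ t ⟧ₛ
  ⟦⟧ₛ-homo Sign.+ t      = sym (*-identityˡ _)
  ⟦⟧ₛ-homo Sign.- Sign.+ = sym (*-identityʳ _)
  ⟦⟧ₛ-homo Sign.- Sign.- = sym (trans (-1*x≈-x _) (-‿involutive _))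

  ◃-homo : ∀ s n → ⟦ s ◃ n ⟧ℤ ≈ ⟦ s ⟧ₛ * (n ×′ 1#)
  ◃-homo s      zero    = sym (zeroʳ _)
  ◃-homo Sign.+ (suc n) = sym (*-identityˡ _)
  ◃-homo Sign.- (suc n) = sym (-1*x≈-x _)

  sign-abs-homo : ∀ i → ⟦ i ⟧ℤ ≈ ⟦ sign i ⟧ₛ * (∣ i ∣ ×′ 1#)
  sign-abs-homo i = trans (reflexive (≡.cong ⟦_⟧ℤ (≡.sym (ℤ.signᵢ◃∣i∣≡i i)))) (◃-homo (sign i) ∣ i ∣)

  *-homo : ∀ i j → ⟦ i ℤ.* j ⟧ℤ ≈ ⟦ i ⟧ℤ * ⟦ j ⟧ℤ
  *-homo i j = begin
    ⟦ (sign i Sign.* sign j) ◃ (∣ i ∣ ℕ.* ∣ j ∣) ⟧ℤ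
      ≈⟨ ◃-homo (sign i Sign.* sign j) (∣ i ∣ ℕ.* ∣ j ∣) ⟩
    ⟦ sign i Sign.* sign j ⟧ₛ * ((∣ i ∣ ℕ.* ∣ j ∣) ×′ 1#)
      ≈⟨ *-cong (⟦⟧ₛ-homo (sign i) (sign j)) (×1-homo-* ∣ i ∣ ∣ j ∣) ⟩
    (⟦ sign i ⟧ₛ * ⟦ sign j ⟧ₛ) * ((∣ i ∣ ×′ 1#) * (∣ j ∣ ×′ 1#))
      ≈⟨ interchange _ _ _ _ ⟩
    (⟦ sign i ⟧ₛ * (∣ i ∣ ×′ 1#)) * (⟦ sign j ⟧ₛ * (∣ j ∣ ×′ 1#))
      ≈⟨ *-cong (sign-abs-homo i) (sign-abs-homo j) ⟨
    ⟦ i ⟧ℤ * ⟦ j ⟧ℤ                                                ∎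

  ⟦⟧ℤ-morphism : ℤ.+-*-rawRing -Raw-AlmostCommutative⟶ fromCommutativeRing R
  ⟦⟧ℤ-morphism = record
    { ⟦_⟧ = ⟦_⟧ℤ ; +-homo = +-homo ; *-homo = *-homo ; -‿homo = -‿homo ; 0-homo = refl ; 1-homo = refl }

  ⟦⟧ℤ-≟ : WeaklyDecidable (Induced-equivalence ⟦⟧ℤ-morphism)
  ⟦⟧ℤ-≟ i j with i ℤ.≟ j
  ... | yes ≡.refl = just refl
  ... | no _       = nothing

  open import Algebra.Solver.Ring ℤ.+-*-rawRing (fromCommutativeRing R) ⟦⟧ℤ-morphism ⟦⟧ℤ-≟ public
    using (solve; _:=_; _:+_; _:-_; _:*_; :-_; con)

prime∤! : ∀ {p} → Prime p → ∀ {m} → m < p → p ∤ m !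
prime∤! pr {zero}  _   p∣1   = ℕ.nonTrivial⇒≢1 {{prime⇒nonTrivial pr}} (∣1⇒≡1 p∣1)
prime∤! pr {suc m} m<p p∣m! with euclidsLemma (suc m) (m !) pr p∣m!
... | inj₁ p∣1+m = ℕ.<⇒≱ m<p (∣⇒≤ p∣1+m)
... | inj₂ p∣m!  = prime∤! pr (ℕ.<-trans (ℕ.n<1+n m) m<p) p∣m!

prime∣C : ∀ {p k} → Prime p → 0 < k → k < p → p ∣ p C k
prime∣C {p@(suc p-1)} {k} pr 0<k k<p
  with euclidsLemma (p C k) (k ! ℕ.* (p ℕ.∸ k) !) pr p∣C*k![p∸k]!
  where
  instance
    k![p∸k]!≢0 : ℕ.NonZero (k ! ℕ.* (p ℕ.∸ k) !)
    k![p∸k]!≢0 = ℕ._!*_!≢0 k (p ℕ.∸ k)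
  C*k![p∸k]!≡p! : (p C k) ℕ.* (k ! ℕ.* (p ℕ.∸ k) !) ≡ p !
  C*k![p∸k]!≡p! = ≡.trans (≡.cong (ℕ._* (k ! ℕ.* (p ℕ.∸ k) !)) (nCk≡n!/k![n-k]! (ℕ.<⇒≤ k<p)))
                          (m/n*n≡m (k![n∸k]!∣n! (ℕ.<⇒≤ k<p)))
  p∣C*k![p∸k]! : p ∣ (p C k) ℕ.* (k ! ℕ.* (p ℕ.∸ k) !)
  p∣C*k![p∸k]! = ≡.subst (p ∣_) (≡.sym C*k![p∸k]!≡p!) (divides (p-1 !) (ℕ.*-comm p (p-1 !)))
... | inj₁ p∣C = p∣C
... | inj₂ p∣k![p∸k]! with euclidsLemma (k !) ((p ℕ.∸ k) !) pr p∣k![p∸k]!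
...   | inj₁ p∣k!     = ⊥-elim (prime∤! pr k<p p∣k!)
...   | inj₂ p∣[p∸k]! = ⊥-elim (prime∤! pr (ℕ.∸-monoʳ-< 0<k (ℕ.<⇒≤ k<p)) p∣[p∸k]!)

module _ {a} {P : ℕ → Set a}
         (+-closed : ∀ i j → P i → P j → P (i ℕ.+ j))
         (∸-closed : ∀ i j → P j → P (i ℕ.+ j) → P i) where

  *-closed : ∀ k {m} → P m → P (k ℕ.* m)
  *-closed zero    {m} Pm = ∸-closed 0 m Pm Pm
  *-closed (suc k) {m} Pm = +-closed m (k ℕ.* m) Pm (*-closed k Pm)

  gcd-closed : ∀ {m n} → P m → P n → P (gcd m n)
  gcd-closed {m} {n} Pm Pn with Bézout.identity (gcd-GCD m n)
  ... | Bézout.+- x y d+yn≡xm = ∸-closed (gcd m n) (y ℕ.* n) (*-closed y Pn) (≡.subst P (≡.sym d+yn≡xm) (*-closed x Pm))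
  ... | Bézout.-+ x y d+xm≡yn = ∸-closed (gcd m n) (x ℕ.* m) (*-closed x Pm) (≡.subst P (≡.sym d+xm≡yn) (*-closed y Pn))

data EvenOdd : ℕ → Set where
  even : ∀ j → EvenOdd (j ℕ.* 2)
  odd  : ∀ j → EvenOdd (suc (j ℕ.* 2))

evenOdd : ∀ n → EvenOdd n
evenOdd zero = even 0
evenOdd (suc n) with evenOdd n
... | even j = odd j
... | odd j  = even (suc j)

module _ {a} {A : Set a} where

  iter-+ : ∀ (h : A → A) i j x → iter h (i ℕ.+ j) x ≡ iter h i (iter h j x)
  iter-+ h zero    j x = ≡.refl
  iter-+ h (suc i) j x = ≡.cong h (iter-+ h i j x)

  iter-* : ∀ (h : A → A) k g x → iter h (k ℕ.* g) x ≡ iter (iter h g) k x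
  iter-* h zero    g x = ≡.refl
  iter-* h (suc k) g x = ≡.trans (iter-+ h g (k ℕ.* g) x) (≡.cong (iter h g) (iter-* h k g x))

  iter-preserves : ∀ {p} {P : A → Set p} {h : A → A} → (∀ {x} → P x → P (h x)) →
                   ∀ k {x} → P x → P (iter h k x)
  iter-preserves h-pres zero    Px = Px
  iter-preserves {P = P} h-pres (suc k) Px = h-pres (iter-preserves {P = P} h-pres k Px)

module _ {a ℓ} (S : Setoid a ℓ) where

  open Setoid S

  iter-cong : ∀ {h} → (∀ {x y} → x ≈ y → h x ≈ h y) → ∀ k {x y} → x ≈ y → iter h k x ≈ iter h k y
  iter-cong h-cong zero    x≈y = x≈y
  iter-cong h-cong (suc k) x≈y = h-cong (iter-cong h-cong k x≈y)

  iter-fixed : ∀ {h} → (∀ {x y} → x ≈ y → h x ≈ h y) → ∀ {x} → h x ≈ x → ∀ k → iter h k x ≈ x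
  iter-fixed h-cong hx≈x zero    = refl
  iter-fixed h-cong hx≈x (suc k) = trans (h-cong (iter-fixed h-cong hx≈x k)) hx≈x

  iter-agree : ∀ {p} {P : Carrier → Set p} {h h′} → (∀ {x y} → x ≈ y → h x ≈ h y) →
               (∀ {x} → P x → P (h′ x)) → (∀ {x} → P x → h x ≈ h′ x) →
               ∀ k {x} → P x → iter h k x ≈ iter h′ k x
  iter-agree h-cong h′-pres h≈h′ zero    Px = refl
  iter-agree {P = P} h-cong h′-pres h≈h′ (suc k) Px =
    trans (h-cong (iter-agree h-cong h′-pres h≈h′ k Px)) (h≈h′ (iter-preserves {P = P} h′-pres k Px))

module _ {c ℓ} (R : CommutativeSemiring c ℓ) where

  open CommutativeSemiring R
  open import Algebra.Properties.CommutativeSemiring.Exp R using () renaming (_^_ to _^ᵣ_)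
  open import Algebra.Properties.Semiring.Mult semiring using () renaming (_×_ to _×ᵤ_)
  open import Algebra.Properties.Monoid.Sum +-monoid using (sum; sum-init-last; sum-cong-≋; sum-replicate-zero)
  open import Relation.Binary.Reasoning.Setoid setoid

  freshmansDream : ∀ {n} → 0 < n → (∀ {k} → 0 < k → k < n → ∀ z → (n C k) ×ᵤ z ≈ 0#) →
                   ∀ x y → (x + y) ^ᵣ n ≈ x ^ᵣ n + y ^ᵣ n
  freshmansDream {suc n} _ C≈0 x y = begin
    (x + y) ^ᵣ suc n                                      ≈⟨ theorem (*-comm x y) (suc n) ⟩
    term Fin.zero + sum (tail term)
      ≈⟨ +-cong first (trans (sum-init-last (tail term)) (+-congʳ interior)) ⟩
    y ^ᵣ suc n + (0# + last (tail term))                  ≈⟨ +-congˡ (trans (+-identityˡ _) final) ⟩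
    y ^ᵣ suc n + x ^ᵣ suc n                                ≈⟨ +-comm _ _ ⟩
    x ^ᵣ suc n + y ^ᵣ suc n                                ∎
    where
    open import Algebra.Properties.Semiring.Binomial semiring x y using (binomialTerm; theorem)
    term : Fin.Fin (suc (suc n)) → Carrier
    term = binomialTerm (suc n)
    first : term Fin.zero ≈ y ^ᵣ suc n
    first = trans (+-identityʳ _) (*-identityˡ _)
    interior : sum (init (tail term)) ≈ 0#
    interior = trans (sum-cong-≋ (λ i → C≈0 (s≤s z≤n) (s≤s (Fin.inject₁ℕ< i)) _)) (sum-replicate-zero n)
    final : last (tail term) ≈ x ^ᵣ suc n
    final = begin
      last (tail term)
        ≡⟨ ≡.cong (λ k → (suc n C k) ×ᵤ (x ^ᵣ k * y ^ᵣ (suc n ℕ.∸ k))) (Fin.toℕ-fromℕ (suc n)) ⟩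
      (suc n C suc n) ×ᵤ (x ^ᵣ suc n * y ^ᵣ (suc n ℕ.∸ suc n))
        ≡⟨ ≡.cong₂ (λ a b → a ×ᵤ (x ^ᵣ suc n * y ^ᵣ b)) (nCn≡1 (suc n)) (ℕ.n∸n≡0 n) ⟩
      1 ×ᵤ (x ^ᵣ suc n * 1#)                                ≈⟨ trans (+-identityʳ _) (*-identityʳ _) ⟩
      x ^ᵣ suc n                                            ∎

module FieldProperties {c ℓ} (K : Field c ℓ) where

  open Field K
  open FieldOps K
  open import Algebra.Properties.CommutativeSemiring.Exp commutativeSemiring
    using (^-congˡ; ^-assocʳ; ^-distrib-*) renaming (_^_ to _^ᵣ_)
  open import Algebra.Properties.Semiring.Mult semiring
    using (×-homo-+; ×1-homo-*) renaming (_×_ to _×ᵤ_)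
  open import Relation.Binary.Reasoning.Setoid setoid

  natCast≡×1 : ∀ n → natCast n ≡ n ×ᵤ 1#
  natCast≡×1 zero    = ≡.refl
  natCast≡×1 (suc n) = ≡.cong (1# +_) (natCast≡×1 n)

  pow≡^ : ∀ x n → pow x n ≡ x ^ᵣ n
  pow≡^ x zero    = ≡.refl
  pow≡^ x (suc n) = ≡.cong (x *_) (pow≡^ x n)

  natCast-+ : ∀ m n → natCast (m ℕ.+ n) ≈ natCast m + natCast n
  natCast-+ m n rewrite natCast≡×1 (m ℕ.+ n) | natCast≡×1 m | natCast≡×1 n = ×-homo-+ 1# m n

  natCast-* : ∀ m n → natCast (m ℕ.* n) ≈ natCast m * natCast n
  natCast-* m n rewrite natCast≡×1 (m ℕ.* n) | natCast≡×1 m | natCast≡×1 n = ×1-homo-* m n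

  pow-cong : ∀ n {x y} → x ≈ y → pow x n ≈ pow y n
  pow-cong n {x} {y} x≈y rewrite pow≡^ x n | pow≡^ y n = ^-congˡ n x≈y

  pow-* : ∀ x m n → pow x (m ℕ.* n) ≈ pow (pow x m) n
  pow-* x m n rewrite pow≡^ x (m ℕ.* n) | pow≡^ x m | pow≡^ (x ^ᵣ m) n = sym (^-assocʳ x m n)

  pow-distrib-* : ∀ x y n → pow (x * y) n ≈ pow x n * pow y n
  pow-distrib-* x y n rewrite pow≡^ (x * y) n | pow≡^ x n | pow≡^ y n = ^-distrib-* x y n

  pow-1# : ∀ n → pow 1# n ≈ 1#
  pow-1# zero    = refl
  pow-1# (suc n) = trans (*-identityˡ _) (pow-1# n)

  x*y≈0⇒y≈0 : ∀ {x y} → x * y ≈ 0# → ¬ (x ≈ 0#) → y ≈ 0#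
  x*y≈0⇒y≈0 {x} {y} xy≈0 x≉0 with inverse x x≉0
  ... | x⁻¹ , xx⁻¹≈1 = begin
    y               ≈⟨ *-identityˡ y ⟨
    1# * y          ≈⟨ *-congʳ xx⁻¹≈1 ⟨
    (x * x⁻¹) * y   ≈⟨ *-congʳ (*-comm x x⁻¹) ⟩
    (x⁻¹ * x) * y   ≈⟨ *-assoc x⁻¹ x y ⟩
    x⁻¹ * (x * y)   ≈⟨ *-congˡ xy≈0 ⟩
    x⁻¹ * 0#        ≈⟨ zeroʳ x⁻¹ ⟩
    0#              ∎

module PolynomialFunctions {c ℓ} (K : Field c ℓ) where

  open Field K
  open FieldOps K
  open FieldProperties K
  open IntegerCoefficientRingSolver commRing
  open import Algebra.Properties.Ring ring using (x∙y⁻¹≈ε⇒x≈y)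
  open import Relation.Binary.Reasoning.Setoid setoid

  -- Polynomial functions of degree ≤ n with coefficient a at zⁿ, described through the factor theorem
  -- instead of coefficient lists.
  IsPolynomial : ℕ → Carrier → (Carrier → Carrier) → Set (c ⊔ ℓ)
  IsPolynomial zero    a f = ∀ z → f z ≈ a
  IsPolynomial (suc n) a f = ∀ r → ∃[ q ] IsPolynomial n a q × (∀ z → f z ≈ (z - r) * q z + f r)

  isPolynomial-cong : ∀ n {a b f g} → a ≈ b → (∀ z → f z ≈ g z) → IsPolynomial n a f → IsPolynomial n b g
  isPolynomial-cong zero    a≈b f≈g f≈a = λ z → trans (sym (f≈g z)) (trans (f≈a z) a≈b)
  isPolynomial-cong (suc n) a≈b f≈g f-poly r with f-poly r
  ... | q , q-poly , f≈[z-r]q+fr =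
    q , isPolynomial-cong n a≈b (λ _ → refl) q-poly ,
    λ z → trans (sym (f≈g z)) (trans (f≈[z-r]q+fr z) (+-congˡ (f≈g r)))

  isPolynomial-const : ∀ a → IsPolynomial 0 a (λ _ → a)
  isPolynomial-const a _ = refl

  isPolynomial-raise : ∀ n {a f} → IsPolynomial n a f → IsPolynomial (suc n) 0# f
  isPolynomial-raise zero {f = f} f≈a r =
    (λ _ → 0#) , isPolynomial-const 0# ,
    λ z → trans (trans (f≈a z) (sym (f≈a r))) (solve 2 (λ u v → v := u :* con (ℤ.+ 0) :+ v) refl (z - r) (f r))
  isPolynomial-raise (suc n) f-poly r with f-poly r
  ... | q , q-poly , f≈[z-r]q+fr = q , isPolynomial-raise n q-poly , f≈[z-r]q+fr

  isPolynomial-constₛ : ∀ n a → IsPolynomial (suc n) 0# (λ _ → a)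
  isPolynomial-constₛ zero    a = isPolynomial-raise 0 (isPolynomial-const a)
  isPolynomial-constₛ (suc n) a = isPolynomial-raise (suc n) (isPolynomial-constₛ n a)

  isPolynomial-+ : ∀ n {a b f g} → IsPolynomial n a f → IsPolynomial n b g →
                   IsPolynomial n (a + b) (λ z → f z + g z)
  isPolynomial-+ zero f≈a g≈b = λ z → +-cong (f≈a z) (g≈b z)
  isPolynomial-+ (suc n) {f = f} {g} f-poly g-poly r with f-poly r | g-poly r
  ... | q , q-poly , f≈[z-r]q+fr | q′ , q′-poly , g≈[z-r]q′+gr =
    (λ z → q z + q′ z) , isPolynomial-+ n q-poly q′-poly , λ z → begin
      f z + g z                                          ≈⟨ +-cong (f≈[z-r]q+fr z) (g≈[z-r]q′+gr z) ⟩
      ((z - r) * q z + f r) + ((z - r) * q′ z + g r)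
        ≈⟨ solve 5 (λ u a b c d → (u :* a :+ b) :+ (u :* c :+ d) := u :* (a :+ c) :+ (b :+ d))
                 refl (z - r) (q z) (f r) (q′ z) (g r) ⟩
      (z - r) * (q z + q′ z) + (f r + g r)               ∎

  isPolynomial-z* : ∀ n {a f} → IsPolynomial n a f → IsPolynomial (suc n) a (λ z → z * f z)
  isPolynomial-z* zero {a} {f} f≈a r = (λ _ → a) , isPolynomial-const a , λ z → begin
    z * f z                  ≈⟨ *-congˡ (f≈a z) ⟩
    z * a                    ≈⟨ solve 3 (λ z r a → z :* a := (z :- r) :* a :+ r :* a) refl z r a ⟩
    (z - r) * a + r * a      ≈⟨ +-congˡ (*-congˡ (f≈a r)) ⟨
    (z - r) * a + r * f r    ∎
  isPolynomial-z* (suc n) {a} {f} f-poly r with f-poly r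
  ... | q , q-poly , f≈[z-r]q+fr =
    (λ z → z * q z + f r) ,
    isPolynomial-cong (suc n) (+-identityʳ a) (λ _ → refl)
      (isPolynomial-+ (suc n) (isPolynomial-z* n q-poly) (isPolynomial-constₛ n (f r))) ,
    λ z → begin
      z * f z                                  ≈⟨ *-congˡ (f≈[z-r]q+fr z) ⟩
      z * ((z - r) * q z + f r)
        ≈⟨ solve 4 (λ z r q fr → z :* ((z :- r) :* q :+ fr) := (z :- r) :* (z :* q :+ fr) :+ r :* fr) refl z r (q z) (f r) ⟩
      (z - r) * (z * q z + f r) + r * f r      ∎

  isPolynomial-pow : ∀ n → IsPolynomial n 1# (λ z → pow z n)
  isPolynomial-pow zero    = isPolynomial-const 1#
  isPolynomial-pow (suc n) = isPolynomial-z* n (isPolynomial-pow n)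

  isPolynomial-pow-id : ∀ n → 2 ≤ n → IsPolynomial n 1# (λ z → pow z n - z)
  isPolynomial-pow-id 1             (s≤s ())
  isPolynomial-pow-id (suc (suc n)) _ =
    isPolynomial-cong (suc (suc n)) (+-identityʳ 1#) (λ z → +-congˡ (solve 1 (λ z → z :* :- con (ℤ.+ 1) := :- z) refl z))
      (isPolynomial-+ (suc (suc n)) (isPolynomial-pow (suc (suc n))) (isPolynomial-z* (suc n) (isPolynomial-constₛ n (- 1#))))

  distinctRoots⇒top≈0 : ∀ n {a f} → IsPolynomial n a f → (r : ℕ → Carrier) →
                        (∀ {i} → i ≤ n → f (r i) ≈ 0#) →
                        (∀ {i j} → i < j → j ≤ n → ¬ (r i ≈ r j)) → a ≈ 0#
  distinctRoots⇒top≈0 zero    f≈a r roots _ = trans (sym (f≈a (r 0))) (roots z≤n)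
  distinctRoots⇒top≈0 (suc n) {f = f} f-poly r roots distinct with f-poly (r 0)
  ... | q , q-poly , f≈[z-r₀]q+fr₀ =
    distinctRoots⇒top≈0 n q-poly (λ i → r (suc i)) q-roots (λ i<j j≤n → distinct (s≤s i<j) (s≤s j≤n))
    where
    q-roots : ∀ {i} → i ≤ n → q (r (suc i)) ≈ 0#
    q-roots {i} i≤n =
      x*y≈0⇒y≈0 [rᵢ-r₀]q≈0 (λ rᵢ-r₀≈0 → distinct (s≤s z≤n) (s≤s i≤n) (sym (x∙y⁻¹≈ε⇒x≈y _ _ rᵢ-r₀≈0)))
      where
      [rᵢ-r₀]q≈0 : (r (suc i) - r 0) * q (r (suc i)) ≈ 0#
      [rᵢ-r₀]q≈0 = begin
        (r (suc i) - r 0) * q (r (suc i))           ≈⟨ +-identityʳ _ ⟨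
        (r (suc i) - r 0) * q (r (suc i)) + 0#      ≈⟨ +-congˡ (roots z≤n) ⟨
        (r (suc i) - r 0) * q (r (suc i)) + f (r 0) ≈⟨ f≈[z-r₀]q+fr₀ (r (suc i)) ⟨
        f (r (suc i))                               ≈⟨ roots (s≤s i≤n) ⟩
        0#                                          ∎

module Frobenius {c ℓ} (K : Field c ℓ) {p} (p-prime : Prime p)
                 (char-p : Field._≈_ K (FieldOps.natCast K p) (Field.0# K)) where

  open Field K
  open FieldOps K
  open FieldProperties K
  open import Algebra.Properties.Ring ring using (x+x≈x⇒x≈0; +-inverseˡ-unique; +-cancelˡ)
  open import Algebra.Properties.Semiring.Mult semiring using (×-assoc-*; ×-congʳ) renaming (_×_ to _×ᵤ_)
  open import Relation.Binary.Reasoning.Setoid setoid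

  natCast-*-zero : ∀ k {m} → natCast m ≈ 0# → natCast (k ℕ.* m) ≈ 0#
  natCast-*-zero k {m} m≈0 = trans (natCast-* k m) (trans (*-congˡ m≈0) (zeroʳ _))

  natCast-suc≉0 : ∀ {a b} → suc a ≡ b → natCast a ≈ 0# → ¬ (natCast b ≈ 0#)
  natCast-suc≉0 ≡.refl a≈0 1+a≈0 = nontrivial (trans (sym (trans (+-congˡ a≈0) (+-identityʳ 1#))) 1+a≈0)

  natCast≉0 : ∀ {k} → 0 < k → k < p → ¬ (natCast k ≈ 0#)
  natCast≉0 {suc k} _ k<p k≈0 with coprime-Bézout (prime⇒coprime p-prime k<p)
  ... | Bézout.+- x y 1+y[1+k]≡xp = natCast-suc≉0 1+y[1+k]≡xp (natCast-*-zero y k≈0) (natCast-*-zero x char-p)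
  ... | Bézout.-+ x y 1+xp≡y[1+k] = natCast-suc≉0 1+xp≡y[1+k] (natCast-*-zero x char-p) (natCast-*-zero y k≈0)

  natCast-injective< : ∀ {i j} → i < j → j < p → ¬ (natCast i ≈ natCast j)
  natCast-injective< {i} {j} i<j j<p i≈j =
    natCast≉0 (ℕ.m<n⇒0<n∸m i<j) (ℕ.≤-<-trans (ℕ.m∸n≤m j i) j<p) (+-cancelˡ (natCast i) _ _ i+[j∸i]≈i+0)
    where
    i+[j∸i]≈i+0 : natCast i + natCast (j ℕ.∸ i) ≈ natCast i + 0#
    i+[j∸i]≈i+0 = begin
      natCast i + natCast (j ℕ.∸ i)  ≈⟨ natCast-+ i (j ℕ.∸ i) ⟨
      natCast (i ℕ.+ (j ℕ.∸ i))      ≡⟨ ≡.cong natCast (ℕ.m+[n∸m]≡n (ℕ.<⇒≤ i<j)) ⟩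
      natCast j                      ≈⟨ i≈j ⟨
      natCast i                      ≈⟨ +-identityʳ _ ⟨
      natCast i + 0#                 ∎

  ∣⇒×≈0 : ∀ {n} → p ∣ n → ∀ z → n ×ᵤ z ≈ 0#
  ∣⇒×≈0 {n} (divides k ≡.refl) z = begin
    n ×ᵤ z              ≈⟨ ×-congʳ n (*-identityˡ z) ⟨
    n ×ᵤ (1# * z)       ≈⟨ ×-assoc-* n 1# z ⟨
    (n ×ᵤ 1#) * z       ≡⟨ ≡.cong (_* z) (natCast≡×1 n) ⟨
    natCast n * z       ≈⟨ *-congʳ (natCast-*-zero k char-p) ⟩
    0# * z              ≈⟨ zeroˡ z ⟩
    0#                  ∎

  φ : Carrier → Carrier
  φ x = pow x p

  φ-cong : ∀ {x y} → x ≈ y → φ x ≈ φ y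
  φ-cong = pow-cong p

  φ-+ : ∀ x y → φ (x + y) ≈ φ x + φ y
  φ-+ x y rewrite pow≡^ (x + y) p | pow≡^ x p | pow≡^ y p =
    freshmansDream commutativeSemiring (ℕ.>-nonZero⁻¹ p {{prime⇒nonZero p-prime}})
      (λ 0<k k<p → ∣⇒×≈0 (prime∣C p-prime 0<k k<p)) x y

  φ-* : ∀ x y → φ (x * y) ≈ φ x * φ y
  φ-* x y = pow-distrib-* x y p

  φ-1 : φ 1# ≈ 1#
  φ-1 = pow-1# p

  φ-0 : φ 0# ≈ 0#
  φ-0 = x+x≈x⇒x≈0 (φ 0#) (trans (sym (φ-+ 0# 0#)) (φ-cong (+-identityʳ 0#)))

  φ-neg : ∀ x → φ (- x) ≈ - φ x
  φ-neg x = +-inverseˡ-unique (φ (- x)) (φ x)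
    (trans (sym (φ-+ (- x) x)) (trans (φ-cong (-‿inverseˡ x)) φ-0))

  φ-sub : ∀ x y → φ (x - y) ≈ φ x - φ y
  φ-sub x y = trans (φ-+ x (- y)) (+-congˡ (φ-neg y))

  φ-natCast : ∀ n → φ (natCast n) ≈ natCast n
  φ-natCast zero    = φ-0
  φ-natCast (suc n) = trans (φ-+ 1# (natCast n)) (+-cong φ-1 (φ-natCast n))

  Fixed : Carrier → Set ℓ
  Fixed x = φ x ≈ x

  fixed-resp : ∀ {x y} → x ≈ y → Fixed x → Fixed y
  fixed-resp x≈y φx≈x = trans (φ-cong (sym x≈y)) (trans φx≈x x≈y)

  fixed-+ : ∀ {x y} → Fixed x → Fixed y → Fixed (x + y)
  fixed-+ φx≈x φy≈y = trans (φ-+ _ _) (+-cong φx≈x φy≈y)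

  fixed-neg : ∀ {x} → Fixed x → Fixed (- x)
  fixed-neg φx≈x = trans (φ-neg _) (-‿cong φx≈x)

  fixed-sub : ∀ {x y} → Fixed x → Fixed y → Fixed (x - y)
  fixed-sub φx≈x φy≈y = fixed-+ φx≈x (fixed-neg φy≈y)

  fixed-* : ∀ {x y} → Fixed x → Fixed y → Fixed (x * y)
  fixed-* φx≈x φy≈y = trans (φ-* _ _) (*-cong φx≈x φy≈y)

  fixed-inverse : ∀ {x y} → Fixed x → x * y ≈ 1# → Fixed y
  fixed-inverse {x} {y} φx≈x xy≈1 = begin
    φ y               ≈⟨ *-identityʳ (φ y) ⟨
    φ y * 1#          ≈⟨ *-congˡ xy≈1 ⟨
    φ y * (x * y)     ≈⟨ *-assoc (φ y) x y ⟨
    (φ y * x) * y     ≈⟨ *-congʳ (trans (*-comm (φ x) (φ y)) (*-congˡ φx≈x)) ⟨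
    (φ x * φ y) * y   ≈⟨ *-congʳ (φ-* x y) ⟨
    φ (x * y) * y     ≈⟨ *-congʳ (trans (φ-cong xy≈1) φ-1) ⟩
    1# * y            ≈⟨ *-identityˡ y ⟩
    y                 ∎

  fixed⇒¬¬InPrimeField : ∀ {x} → Fixed x → ¬ ¬ InPrimeField x
  fixed⇒¬¬InPrimeField {x} φx≈x x∉𝔽ₚ =
    nontrivial (distinctRoots⇒top≈0 p (isPolynomial-pow-id p 2≤p) root roots distinct)
    where
    open PolynomialFunctions K
    2≤p : 2 ≤ p
    2≤p = ℕ.nonTrivial⇒n>1 p {{prime⇒nonTrivial p-prime}}
    root : ℕ → Carrier
    root zero    = x
    root (suc i) = natCast i
    fixed⇒root : ∀ {y} → Fixed y → φ y - y ≈ 0#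
    fixed⇒root {y} φy≈y = trans (+-congʳ φy≈y) (-‿inverseʳ y)
    roots : ∀ {i} → i ≤ p → φ (root i) - root i ≈ 0#
    roots {zero}  _ = fixed⇒root φx≈x
    roots {suc i} _ = fixed⇒root (φ-natCast i)
    distinct : ∀ {i j} → i < j → j ≤ p → ¬ (root i ≈ root j)
    distinct {zero}  {suc j} _          _   x≈j = x∉𝔽ₚ (j , x≈j)
    distinct {suc i} {suc j} (s≤s i<j) j<p = natCast-injective< i<j j<p

  Fixed² : Carrier → Set ℓ
  Fixed² x = φ (φ x) ≈ x

  fixed²-resp : ∀ {x y} → x ≈ y → Fixed² x → Fixed² y
  fixed²-resp x≈y φφx≈x = trans (φ-cong (φ-cong (sym x≈y))) (trans φφx≈x x≈y)

  fixed²-+ : ∀ {x y} → Fixed² x → Fixed² y → Fixed² (x + y)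
  fixed²-+ φφx≈x φφy≈y = trans (φ-cong (φ-+ _ _)) (trans (φ-+ _ _) (+-cong φφx≈x φφy≈y))

  fixed²-sub : ∀ {x y} → Fixed² x → Fixed² y → Fixed² (x - y)
  fixed²-sub φφx≈x φφy≈y = trans (φ-cong (φ-sub _ _)) (trans (φ-sub _ _) (+-cong φφx≈x (-‿cong φφy≈y)))

  fixed²-φ : ∀ {x} → Fixed² x → Fixed² (φ x)
  fixed²-φ = φ-cong

  iter-φ-even : ∀ j {x} → Fixed² x → iter φ (j ℕ.* 2) x ≈ x
  iter-φ-even zero    _      = refl
  iter-φ-even (suc j) φφx≈x = trans (φ-cong (φ-cong (iter-φ-even j φφx≈x))) φφx≈x

  iter-φ-odd : ∀ j {x} → Fixed² x → iter φ (suc (j ℕ.* 2)) x ≈ φ x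
  iter-φ-odd j φφx≈x = φ-cong (iter-φ-even j φφx≈x)

  iter-φ-sub : ∀ k x y → iter φ k (x - y) ≈ iter φ k x - iter φ k y
  iter-φ-sub zero    x y = refl
  iter-φ-sub (suc k) x y = trans (φ-cong (iter-φ-sub k x y)) (φ-sub _ _)

  pow-p^ : ∀ k x → pow x (p ℕ.^ k) ≈ iter φ k x
  pow-p^ zero    x = *-identityʳ x
  pow-p^ (suc k) x = begin
    pow x (p ℕ.* p ℕ.^ k)     ≡⟨ ≡.cong (pow x) (ℕ.*-comm p (p ℕ.^ k)) ⟩
    pow x (p ℕ.^ k ℕ.* p)     ≈⟨ pow-* x (p ℕ.^ k) p ⟩
    φ (pow x (p ℕ.^ k))       ≈⟨ φ-cong (pow-p^ k x) ⟩
    φ (iter φ k x)            ∎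

  InFp2⇒fixed² : ∀ {x} → InFp2 p x → Fixed² x
  InFp2⇒fixed² {x} x^p²≈x = trans (sym (pow-* x p p)) x^p²≈x

  iter-φ-on-fixed² : ∀ n → (∀ {x} → Fixed² x → iter φ n x ≈ x) ⊎ (∀ {x} → Fixed² x → iter φ n x ≈ φ x)
  iter-φ-on-fixed² n with evenOdd n
  ... | even j = inj₁ (iter-φ-even j)
  ... | odd j  = inj₂ (iter-φ-odd j)

module Dynamics {c ℓ} (K : Field c ℓ) {p} (p-prime : Prime p)
                (char-p : Field._≈_ K (FieldOps.natCast K p) (Field.0# K))
                (l : ℕ) (λ₀ : Field.Carrier K) where

  open Field K
  open FieldOps K
  open Frobenius K p-prime char-p
  open IntegerCoefficientRingSolver commRing
  open import Relation.Binary.Reasoning.Setoid setoid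

  f : Carrier → Carrier
  f z = pow z (p ℕ.^ l) + λ₀

  σ : Carrier → Carrier
  σ = iter φ l

  σ-cong : ∀ {x y} → x ≈ y → σ x ≈ σ y
  σ-cong = iter-cong setoid φ-cong l

  iter-f-sub : ∀ k x y → iter f k x - iter f k y ≈ iter σ k (x - y)
  iter-f-sub zero    x y = refl
  iter-f-sub (suc k) x y = begin
    (pow fᵏx (p ℕ.^ l) + λ₀) - (pow fᵏy (p ℕ.^ l) + λ₀)
      ≈⟨ solve 3 (λ u v w → (u :+ w) :- (v :+ w) := u :- v) refl (pow fᵏx (p ℕ.^ l)) (pow fᵏy (p ℕ.^ l)) λ₀ ⟩
    pow fᵏx (p ℕ.^ l) - pow fᵏy (p ℕ.^ l)    ≈⟨ +-cong (pow-p^ l fᵏx) (-‿cong (pow-p^ l fᵏy)) ⟩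
    σ fᵏx - σ fᵏy                           ≈⟨ iter-φ-sub l fᵏx fᵏy ⟨
    σ (fᵏx - fᵏy)                           ≈⟨ σ-cong (iter-f-sub k x y) ⟩
    σ (iter σ k (x - y))                    ∎
    where
    fᵏx fᵏy : Carrier
    fᵏx = iter f k x
    fᵏy = iter f k y

  fixed²-iter-σ : ∀ k {x} → Fixed² x → Fixed² (iter σ k x)
  fixed²-iter-σ = iter-preserves {P = Fixed²} (iter-preserves {P = Fixed²} fixed²-φ l)

  module Displacement (A : Carrier) where

    e : ℕ → Carrier
    e k = iter f k A - A

    e-+ : ∀ i j → e (i ℕ.+ j) ≈ iter σ i (e j) + e i
    e-+ i j = begin
      iter f (i ℕ.+ j) A - A                      ≡⟨ ≡.cong (_- A) (iter-+ f i j A) ⟩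
      iter f i (iter f j A) - A
        ≈⟨ solve 3 (λ u v w → u :- w := (u :- v) :+ (v :- w)) refl (iter f i (iter f j A)) (iter f i A) A ⟩
      (iter f i (iter f j A) - iter f i A) + e i  ≈⟨ +-congʳ (iter-f-sub i (iter f j A) A) ⟩
      iter σ i (e j) + e i                        ∎

    Fixed²Displacement : ℕ → Set ℓ
    Fixed²Displacement k = Fixed² (e k)

    fixed²Displacement-+ : ∀ i j → Fixed²Displacement i → Fixed²Displacement j → Fixed²Displacement (i ℕ.+ j)
    fixed²Displacement-+ i j Pi Pj = fixed²-resp (sym (e-+ i j)) (fixed²-+ (fixed²-iter-σ i Pj) Pi)

    fixed²Displacement-∸ : ∀ i j → Fixed²Displacement j → Fixed²Displacement (i ℕ.+ j) → Fixed²Displacement i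
    fixed²Displacement-∸ i j Pj Pi+j = fixed²-resp e[i+j]-σⁱe[j]≈e[i] (fixed²-sub Pi+j (fixed²-iter-σ i Pj))
      where
      e[i+j]-σⁱe[j]≈e[i] : e (i ℕ.+ j) - iter σ i (e j) ≈ e i
      e[i+j]-σⁱe[j]≈e[i] = trans (+-congʳ (e-+ i j)) (solve 2 (λ u v → (u :+ v) :- u := v) refl (iter σ i (e j)) (e i))

    module Stroboscope (g : ℕ) (Pg : Fixed²Displacement g) where

      τ : Carrier → Carrier
      τ = iter σ g

      τ-cong : ∀ {x y} → x ≈ y → τ x ≈ τ y
      τ-cong = iter-cong setoid σ-cong g

      τ-on-fixed² : (∀ {x} → Fixed² x → τ x ≈ x) ⊎ (∀ {x} → Fixed² x → τ x ≈ φ x)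
      τ-on-fixed² = Sum.map (via {λ x → x}) (via {φ}) (iter-φ-on-fixed² (g ℕ.* l))
        where
        via : ∀ {h} → (∀ {x} → Fixed² x → iter φ (g ℕ.* l) x ≈ h x) → ∀ {x} → Fixed² x → τ x ≈ h x
        via φ^[gl]≈h {x} x-fixed² = trans (reflexive (≡.sym (iter-* φ g l x))) (φ^[gl]≈h x-fixed²)

      μ : Carrier
      μ = e g

      E : ℕ → Carrier
      E j = e (j ℕ.* g)

      E-zero : E 0 ≈ 0#
      E-zero = -‿inverseʳ A

      E-suc : ∀ j → E (suc j) ≈ τ (E j) + μ
      E-suc j = e-+ g (j ℕ.* g)

      fixed²-E : ∀ j → Fixed² (E j)
      fixed²-E j = *-closed {P = Fixed²Displacement} fixed²Displacement-+ fixed²Displacement-∸ j Pg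

      E≈jμ : (∀ {x} → Fixed² x → τ x ≈ x) → ∀ j → E j ≈ natCast j * μ
      E≈jμ τ≈id zero    = trans E-zero (sym (zeroˡ μ))
      E≈jμ τ≈id (suc j) = begin
        E (suc j)              ≈⟨ E-suc j ⟩
        τ (E j) + μ            ≈⟨ +-congʳ (τ≈id (fixed²-E j)) ⟩
        E j + μ                ≈⟨ +-congʳ (E≈jμ τ≈id j) ⟩
        natCast j * μ + μ      ≈⟨ solve 2 (λ J u → J :* u :+ u := (con (ℤ.+ 1) :+ J) :* u) refl (natCast j) μ ⟩
        (1# + natCast j) * μ   ∎

      module _ (τ≈φ : ∀ {x} → Fixed² x → τ x ≈ φ x) where

        φμ+μ-fixed : Fixed (φ μ + μ)
        φμ+μ-fixed = trans (φ-+ (φ μ) μ) (trans (+-congʳ Pg) (+-comm μ (φ μ)))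

        E-even⇒odd : ∀ k → Fixed (E k) → Fixed (E (suc k) - μ)
        E-even⇒odd k Ek-fixed = fixed-resp (sym E[1+k]-μ≈Ek) Ek-fixed
          where
          E[1+k]-μ≈Ek : E (suc k) - μ ≈ E k
          E[1+k]-μ≈Ek = begin
            E (suc k) - μ        ≈⟨ +-congʳ (E-suc k) ⟩
            (τ (E k) + μ) - μ    ≈⟨ solve 2 (λ u v → (u :+ v) :- v := u) refl (τ (E k)) μ ⟩
            τ (E k)              ≈⟨ τ≈φ (fixed²-E k) ⟩
            φ (E k)              ≈⟨ Ek-fixed ⟩
            E k                  ∎

        E-odd⇒even : ∀ k → Fixed (E k - μ) → Fixed (E (suc k))
        E-odd⇒even k Ek-μ-fixed =
          fixed-resp (sym E[1+k]≈[Ek-μ]+[φμ+μ]) (fixed-+ Ek-μ-fixed φμ+μ-fixed)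
          where
          E[1+k]≈[Ek-μ]+[φμ+μ] : E (suc k) ≈ (E k - μ) + (φ μ + μ)
          E[1+k]≈[Ek-μ]+[φμ+μ] = begin
            E (suc k)                    ≈⟨ E-suc k ⟩
            τ (E k) + μ                  ≈⟨ +-congʳ (τ≈φ (fixed²-E k)) ⟩
            φ (E k) + μ                  ≈⟨ solve 3 (λ u v w → u :+ w := (u :- v) :+ (v :+ w)) refl (φ (E k)) (φ μ) μ ⟩
            (φ (E k) - φ μ) + (φ μ + μ)  ≈⟨ +-congʳ (sym (φ-sub (E k) μ)) ⟩
            φ (E k - μ) + (φ μ + μ)      ≈⟨ +-congʳ Ek-μ-fixed ⟩
            (E k - μ) + (φ μ + μ)        ∎

        E-parity : ∀ j → Fixed (E (j ℕ.* 2)) × Fixed (E (suc (j ℕ.* 2)) - μ)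
        E-parity zero    = E0-fixed , E-even⇒odd 0 E0-fixed
          where
          E0-fixed : Fixed (E 0)
          E0-fixed = fixed-resp (sym E-zero) φ-0
        E-parity (suc j) = E2j+2-fixed , E-even⇒odd (suc j ℕ.* 2) E2j+2-fixed
          where
          E2j+2-fixed : Fixed (E (suc j ℕ.* 2))
          E2j+2-fixed = E-odd⇒even (suc (j ℕ.* 2)) (proj₂ (E-parity j))

  module _ {A B C : Carrier} {m n : ℕ}
           (fᵐA≈C : iter f m A ≈ C) (fⁿB≈C : iter f n B ≈ C)
           (a-fixed² : Fixed² (B - A)) (a∉𝔽ₚ : ¬ InPrimeField (B - A))
           (b-fixed² : Fixed² (C - A)) (b∉𝔽ₚ : ¬ InPrimeField (C - A))
           (a-b∉𝔽ₚ : ¬ InPrimeField ((B - A) - (C - A)))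
           (a/b∉𝔽ₚ : ∀ q → q * (C - A) ≈ B - A → ¬ InPrimeField q) where

    open Displacement A

    private
      a b : Carrier
      a = B - A
      b = C - A

    e[m]≈b : e m ≈ b
    e[m]≈b = +-congʳ fᵐA≈C

    e[n]≈b-σⁿa : e n ≈ b - iter σ n a
    e[n]≈b-σⁿa = begin
      iter f n A - A
        ≈⟨ solve 3 (λ x y z → y :- z := (x :- z) :- (x :- y)) refl (iter f n B) (iter f n A) A ⟩
      (iter f n B - A) - (iter f n B - iter f n A)  ≈⟨ +-cong (+-congʳ fⁿB≈C) (-‿cong (iter-f-sub n B A)) ⟩
      b - iter σ n a                                ∎

    fixed²Displacement-gcd : Fixed²Displacement (gcd m n)
    fixed²Displacement-gcd = gcd-closed {P = Fixed²Displacement} fixed²Displacement-+ fixed²Displacement-∸ {m} {n}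
      (fixed²-resp (sym e[m]≈b) b-fixed²)
      (fixed²-resp (sym e[n]≈b-σⁿa) (fixed²-sub b-fixed² (fixed²-iter-σ n a-fixed²)))

    open Stroboscope (gcd m n) fixed²Displacement-gcd

    module _ (M N : ℕ) (E[M]≈b : E M ≈ b) (E[N]≈b-τᴺa : E N ≈ b - iter τ N a) where

      even-case : (∀ {x} → Fixed² x → τ x ≈ x) → ⊥
      even-case τ≈id = ¬¬-excluded-middle M≈0-or-not
        where
        b≈Mμ : b ≈ natCast M * μ
        b≈Mμ = trans (sym E[M]≈b) (E≈jμ τ≈id M)
        b-a≈Nμ : b - a ≈ natCast N * μ
        b-a≈Nμ = trans (+-congˡ (-‿cong (sym (iter-fixed setoid τ-cong (τ≈id a-fixed²) N))))
                       (trans (sym E[N]≈b-τᴺa) (E≈jμ τ≈id N))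
        M≈0-or-not : Dec (natCast M ≈ 0#) → ⊥
        M≈0-or-not (yes M≈0) = b∉𝔽ₚ (0 , trans b≈Mμ (trans (*-congʳ M≈0) (zeroˡ μ)))
        M≈0-or-not (no M≉0) with inverse (natCast M) M≉0
        ... | y , My≈1 = fixed⇒¬¬InPrimeField q-fixed (a/b∉𝔽ₚ q qb≈a)
          where
          q : Carrier
          q = 1# - natCast N * y
          q-fixed : Fixed q
          q-fixed = fixed-sub φ-1 (fixed-* (φ-natCast N) (fixed-inverse (φ-natCast M) My≈1))
          yb≈μ : y * b ≈ μ
          yb≈μ = begin
            y * b                  ≈⟨ *-congˡ b≈Mμ ⟩
            y * (natCast M * μ)    ≈⟨ solve 3 (λ y M u → y :* (M :* u) := (M :* y) :* u) refl y (natCast M) μ ⟩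
            (natCast M * y) * μ    ≈⟨ *-congʳ My≈1 ⟩
            1# * μ                 ≈⟨ *-identityˡ μ ⟩
            μ                      ∎
          qb≈a : q * b ≈ a
          qb≈a = begin
            (1# - natCast N * y) * b
              ≈⟨ solve 3 (λ N y b → (con (ℤ.+ 1) :- (N :* y)) :* b := b :- (N :* (y :* b))) refl (natCast N) y b ⟩
            b - natCast N * (y * b)  ≈⟨ +-congˡ (-‿cong (*-congˡ yb≈μ)) ⟩
            b - natCast N * μ        ≈⟨ +-congˡ (-‿cong b-a≈Nμ) ⟨
            b - (b - a)              ≈⟨ solve 2 (λ b a → b :- (b :- a) := a) refl b a ⟩
            a                        ∎

      odd-case : (∀ {x} → Fixed² x → τ x ≈ φ x) → ⊥
      odd-case τ≈φ = M-case (evenOdd M) E[M]≈b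
        where
        τᵏa≈φᵏa : ∀ k → iter τ k a ≈ iter φ k a
        τᵏa≈φᵏa k = iter-agree setoid τ-cong fixed²-φ τ≈φ k a-fixed²
        M-case : ∀ {k} → EvenOdd k → E k ≈ b → ⊥
        M-case (even j) E≈b = fixed⇒¬¬InPrimeField (fixed-resp E≈b (proj₁ (E-parity τ≈φ j))) b∉𝔽ₚ
        M-case (odd j)  E≈b = N-case (evenOdd N) E[N]≈b-τᴺa
          where
          b-μ-fixed : Fixed (b - μ)
          b-μ-fixed = fixed-resp (+-congʳ E≈b) (proj₂ (E-parity τ≈φ j))
          N-case : ∀ {k} → EvenOdd k → E k ≈ b - iter τ k a → ⊥
          N-case (even j′) E≈b-τᵏa = fixed⇒¬¬InPrimeField a-b-fixed a-b∉𝔽ₚ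
            where
            E≈b-a : E (j′ ℕ.* 2) ≈ b - a
            E≈b-a = trans E≈b-τᵏa (+-congˡ (-‿cong (trans (τᵏa≈φᵏa (j′ ℕ.* 2)) (iter-φ-even j′ a-fixed²))))
            a-b-fixed : Fixed (a - b)
            a-b-fixed = fixed-resp { - (b - a)} (solve 2 (λ a b → :- (b :- a) := a :- b) refl a b)
                                   (fixed-neg (fixed-resp E≈b-a (proj₁ (E-parity τ≈φ j′))))
          N-case (odd j′) E≈b-τᵏa = fixed⇒¬¬InPrimeField a-fixed a∉𝔽ₚ
            where
            k : ℕ
            k = suc (j′ ℕ.* 2)
            [E-μ]-fixed : Fixed (E k - μ)
            [E-μ]-fixed = proj₂ (E-parity τ≈φ j′)
            φa≈[b-μ]-[E-μ] : φ a ≈ (b - μ) - (E k - μ)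
            φa≈[b-μ]-[E-μ] = begin
              φ a                     ≈⟨ trans (τᵏa≈φᵏa k) (iter-φ-odd j′ a-fixed²) ⟨
              iter τ k a              ≈⟨ solve 2 (λ b z → z := b :- (b :- z)) refl b (iter τ k a) ⟩
              b - (b - iter τ k a)    ≈⟨ +-congˡ (-‿cong E≈b-τᵏa) ⟨
              b - E k                 ≈⟨ solve 3 (λ b e u → b :- e := (b :- u) :- (e :- u)) refl b (E k) μ ⟩
              (b - μ) - (E k - μ)     ∎
            φa-fixed : Fixed (φ a)
            φa-fixed = fixed-resp (sym φa≈[b-μ]-[E-μ]) (fixed-sub b-μ-fixed [E-μ]-fixed)
            a-fixed : Fixed a
            a-fixed = trans (sym φa-fixed) a-fixed²

    noCommonTarget : ⊥
    noCommonTarget with gcd[m,n]∣m m n | gcd[m,n]∣n m n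
    ... | divides M m≡Mg | divides N n≡Ng =
      [ even-case M N E[M]≈b E[N]≈b-τᴺa , odd-case M N E[M]≈b E[N]≈b-τᴺa ] τ-on-fixed²
      where
      E[M]≈b : E M ≈ b
      E[M]≈b = ≡.subst (λ k → e k ≈ b) m≡Mg e[m]≈b
      E[N]≈b-τᴺa : E N ≈ b - iter τ N a
      E[N]≈b-τᴺa = ≡.subst (λ z → E N ≈ b - z) (iter-* σ N (gcd m n) a)
                     (≡.subst (λ k → e k ≈ b - iter σ k a) n≡Ng e[n]≈b-σⁿa)

module _ {c₁ ℓ₁ c₂ ℓ₂} (L : Field c₁ ℓ₁) (K : Field c₂ ℓ₂) {ι : Field.Carrier L → Field.Carrier K}
         (ι-homo : RingMorphisms.IsRingHomomorphism (Field.rawRing L) (Field.rawRing K) ι) where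

  open Field K
  open RingMorphisms.IsRingHomomorphism ι-homo

  ι-natCast : ∀ n → ι (FieldOps.natCast L n) ≈ FieldOps.natCast K n
  ι-natCast zero    = 0#-homo
  ι-natCast (suc n) = trans (+-homo _ _) (+-cong 1#-homo (ι-natCast n))

  ι-characteristic : ∀ {p} → Field._≈_ L (FieldOps.natCast L p) (Field.0# L) → FieldOps.natCast K p ≈ 0#
  ι-characteristic {p} char-p = trans (sym (ι-natCast p)) (trans (⟦⟧-cong char-p) 0#-homo)

proposition8p5 : ∀ {c₁ ℓ₁ c₂ ℓ₂ : Level} (L : Field c₁ ℓ₁) (K : Field c₂ ℓ₂) (ι : Field.Carrier L → Field.Carrier K) →
    IsAlgebraicClosure L K ι →
    (p : ℕ) → HasCharacteristic L p →
    (ℓ : ℕ) → 1 ≤ ℓ →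
    (α₁ α₂ β : Field.Carrier L) →
    let open Field K
        open FieldOps K
        d = p ^ ℓ
        δ₁ = ι α₂ - ι α₁
        δ₂ = ι β - ι α₁
    in
    (InFp2 p δ₁ × ¬ InPrimeField δ₁) →
    (InFp2 p δ₂ × ¬ InPrimeField δ₂) →
    ¬ InPrimeField (δ₁ - δ₂) →
    (∀ q → (q * δ₂) ≈ δ₁ → ¬ InPrimeField q) →
    ∀ (λ₀ : Carrier) → ¬ (∃ λ m → ∃ λ n → 1 ≤ m × 1 ≤ n ×
        (iter (λ z → pow z d + λ₀) m (ι α₁) ≈ ι β) ×
        (iter (λ z → pow z d + λ₀) n (ι α₂) ≈ ι β))
proposition8p5 L K ι ι-closure p (p-prime , char-p) ℓ _ α₁ α₂ β
               (δ₁∈𝔽p² , δ₁∉𝔽ₚ) (δ₂∈𝔽p² , δ₂∉𝔽ₚ) δ₁-δ₂∉𝔽ₚ δ₁/δ₂∉𝔽ₚ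
               λ₀ (m , n , _ , _ , fᵐα₁≈β , fⁿα₂≈β) =
  noCommonTarget {ι α₁} {ι α₂} {ι β} {m} {n} fᵐα₁≈β fⁿα₂≈β
    (InFp2⇒fixed² δ₁∈𝔽p²) δ₁∉𝔽ₚ (InFp2⇒fixed² δ₂∈𝔽p²) δ₂∉𝔽ₚ δ₁-δ₂∉𝔽ₚ δ₁/δ₂∉𝔽ₚ
  where
  char-p-K : Field._≈_ K (FieldOps.natCast K p) (Field.0# K)
  char-p-K = ι-characteristic L K (IsAlgebraicClosure.homomorphism ι-closure) {p} char-p
  open Frobenius K p-prime char-p-K using (InFp2⇒fixed²)
  open Dynamics K p-prime char-p-K ℓ λ₀ using (noCommonTarget)
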